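{- Let $n>2$ and consider the directed circulant graph $C_n^+(1,2)$. Every primitive pseudo orbit of length $l$ with $0<l<n$ consists of exactly one primitive periodic orbit, which has length $l$ and walk sum $n$.
   Context: $C_n^+(1,2)$ is the directed graph with vertex set $\{0,1,\dots,n-1\}$ (identified with $\mathbb{Z}/n\mathbb{Z}$) whose bonds are $(v,v+1 \bmod n)$ (arc $1$) and $(v,v+2\bmod n)$ (arc $2$) for every vertex $v$. A circuit of length $l\ge1$ is a sequence $v_0,\dots,v_l=v_0$ with each $(v_i,v_{i+1})$ a bond; its walk sum is the sum of the arcs of its bonds. A periodic orbit is an equivalence class of circuits under cyclic rotation (length and walk sum being those of any of its circuits); it is primitive if it is not a shorter periodic orbit repeated several times. A pseudo orbit is a finite collection of periodic orbits; its length is the sum of their lengths; it is primitive if it consists only of primitive periodic orbits, none repeated. -}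

module Defs where

open import Data.Nat using (ℕ; zero; suc; _+_; _%_; _≤_; NonZero)
open import Data.Fin using (Fin; toℕ)
open import Data.List using (List; []; _∷_; _++_; map; length; take; drop; concat; replicate)
open import Data.Nat.ListAction using (sum)
open import Data.List.Relation.Unary.All using (All)
open import Data.List.Relation.Unary.AllPairs using (AllPairs)
open import Data.Product using (Σ; ∃; _×_; proj₁)
open import Data.Unit using (⊤)
open import Data.Empty using (⊥)
open import Relation.Nullary using (¬_)
open import Relation.Binary.PropositionalEquality using (_≡_)

data Arc : Set where
  arc1 arc2 : Arc

arcVal : Arc → ℕ
arcVal arc1 = 1
arcVal arc2 = 2

-- A bond (v , v + a mod n) of C_n^+(1,2), given by its source v and its arc a.
-- (For n > 2 the bond is determined by its pair of endpoints.)
record Bond (n : ℕ) : Set where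
  constructor bond
  field
    src : Fin n
    arc : Arc
open Bond public

tgtℕ : ∀ {n} .{{_ : NonZero n}} → Bond n → ℕ
tgtℕ {n} b = (toℕ (src b) + arcVal (arc b)) % n

Chain : ∀ {n} .{{_ : NonZero n}} → List (Bond n) → Set
Chain [] = ⊤
Chain (b ∷ []) = ⊤
Chain (b ∷ c ∷ bs) = (tgtℕ b ≡ toℕ (src c)) × Chain (c ∷ bs)

-- A circuit v_0,...,v_l = v_0 (l ≥ 1), encoded as its list of bonds
-- (v_0,v_1),...,(v_{l-1},v_l): nonempty, consecutive bonds linked, and the
-- last bond returns to the start vertex.
IsCircuit : ∀ {n} .{{_ : NonZero n}} → List (Bond n) → Set
IsCircuit [] = ⊥
IsCircuit (b ∷ bs) = Chain ((b ∷ bs) ++ (b ∷ []))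

Circuit : (n : ℕ) .{{_ : NonZero n}} → Set
Circuit n = Σ (List (Bond n)) IsCircuit

bonds : ∀ {n} .{{_ : NonZero n}} → Circuit n → List (Bond n)
bonds = proj₁

len : ∀ {n} .{{_ : NonZero n}} → Circuit n → ℕ
len c = length (bonds c)

walkSum : ∀ {n} .{{_ : NonZero n}} → Circuit n → ℕ
walkSum c = sum (map (λ b → arcVal (arc b)) (bonds c))

rotate : ∀ {A : Set} → ℕ → List A → List A
rotate k xs = drop k xs ++ take k xs

-- Two circuits represent the same periodic orbit iff one is a cyclic rotation
-- of the other. Periodic orbits are represented by circuits modulo SameOrbit.
SameOrbit : ∀ {n} .{{_ : NonZero n}} → Circuit n → Circuit n → Set
SameOrbit c d = ∃ λ k → rotate k (bonds c) ≡ bonds d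

-- A periodic orbit is primitive iff it is not a shorter orbit repeated m ≥ 2
-- times (this property is invariant under rotation).
Primitive : ∀ {n} .{{_ : NonZero n}} → Circuit n → Set
Primitive c = ¬ (∃ λ (d : List (Bond _)) → ∃ λ m → 2 ≤ m × bonds c ≡ concat (replicate m d))

-- A pseudo orbit: a finite collection of periodic orbits (each given by a
-- representing circuit; the order of the list is irrelevant).
PseudoOrbit : (n : ℕ) .{{_ : NonZero n}} → Set
PseudoOrbit n = List (Circuit n)

pseudoLength : ∀ {n} .{{_ : NonZero n}} → PseudoOrbit n → ℕ
pseudoLength γ = sum (map len γ)

PrimitivePseudoOrbit : ∀ {n} .{{_ : NonZero n}} → PseudoOrbit n → Set
PrimitivePseudoOrbit γ = All Primitive γ × AllPairs (λ c d → ¬ SameOrbit c d) γ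

{-# OPTIONS --safe #-}
module Submission where

-- A circuit of length l has walk sum w with l ≤ w ≤ 2l, and w ≡ 0 (mod n)
-- because the walk returns to its start vertex. If l < n then 0 < w < 2n,
-- which forces w = n and hence n ≤ 2l. So every periodic orbit of length
-- below n has length at least n/2, and two of them would already reach n.

open import Defs
open import Data.Nat using (ℕ; zero; suc; _<_; _≤_; _+_; _*_; _%_; _/_; NonZero; z≤n; s≤s)
open import Data.Nat.Properties
open import Data.Nat.DivMod using (m≡m%n+[m/n]*n; %-distribˡ-+; m%n%n≡m%n)
open import Data.Nat.Divisibility using (_∣_; divides)
open import Data.Nat.ListAction using (sum)
open import Data.Fin using (toℕ)
open import Data.List using (List; []; _∷_; _++_; map; length)
open import Data.List.Relation.Unary.All using (_∷_)
open import Data.Product using (∃; _×_; _,_)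
open import Relation.Nullary using (contradiction)
open import Relation.Binary.PropositionalEquality

[m%d+n]%d≡[m+n]%d : ∀ m n d .{{_ : NonZero d}} → (m % d + n) % d ≡ (m + n) % d
[m%d+n]%d≡[m+n]%d m n d = begin
  (m % d + n) % d           ≡⟨ %-distribˡ-+ (m % d) n d ⟩
  (m % d % d + n % d) % d   ≡⟨ cong (λ x → (x + n % d) % d) (m%n%n≡m%n m d) ⟩
  (m % d + n % d) % d       ≡⟨ %-distribˡ-+ m n d ⟨
  (m + n) % d               ∎
  where open ≡-Reasoning

m≡[m+n]%d⇒d∣n : ∀ m n d .{{_ : NonZero d}} → m ≡ (m + n) % d → d ∣ n
m≡[m+n]%d⇒d∣n m n d m≡ = divides ((m + n) / d) (+-cancelˡ-≡ m n _ (begin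
  m + n                         ≡⟨ m≡m%n+[m/n]*n (m + n) d ⟩
  (m + n) % d + (m + n) / d * d ≡⟨ cong (_+ (m + n) / d * d) m≡ ⟨
  m + (m + n) / d * d           ∎))
  where open ≡-Reasoning

d∣n⇒0<n⇒n<2d⇒n≡d : ∀ {n d} → d ∣ n → 0 < n → n < 2 * d → n ≡ d
d∣n⇒0<n⇒n<2d⇒n≡d {d = d} (divides zero refl) () _
d∣n⇒0<n⇒n<2d⇒n≡d {d = d} (divides (suc zero) refl) _ _ = +-identityʳ d
d∣n⇒0<n⇒n<2d⇒n≡d {d = d} (divides (suc (suc q)) refl) _ n<2d =
  contradiction (+-monoʳ-≤ d (≤-trans (≤-reflexive (+-identityʳ d)) (m≤m+n d (q * d)))) (<⇒≱ n<2d)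

arcSum : ∀ {n} → List (Bond n) → ℕ
arcSum bs = sum (map (λ b → arcVal (arc b)) bs)

length≤arcSum : ∀ {n} (bs : List (Bond n)) → length bs ≤ arcSum bs
length≤arcSum []                = z≤n
length≤arcSum (bond _ arc1 ∷ bs) = s≤s (length≤arcSum bs)
length≤arcSum (bond _ arc2 ∷ bs) = ≤-trans (s≤s (length≤arcSum bs)) (n≤1+n _)

arcSum≤2*length : ∀ {n} (bs : List (Bond n)) → arcSum bs ≤ 2 * length bs
arcSum≤2*length []           = z≤n
arcSum≤2*length (b ∷ bs) = begin
  arcVal (arc b) + arcSum bs ≤⟨ +-mono-≤ (arcVal≤2 (arc b)) (arcSum≤2*length bs) ⟩
  2 + 2 * length bs          ≡⟨ *-distribˡ-+ 2 1 (length bs) ⟨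
  2 * length (b ∷ bs)        ∎
  where
  open ≤-Reasoning
  arcVal≤2 : ∀ a → arcVal a ≤ 2
  arcVal≤2 arc1 = s≤s z≤n
  arcVal≤2 arc2 = ≤-refl

Chain⇒src-last : ∀ {n} .{{_ : NonZero n}} (b : Bond n) (bs : List (Bond n)) (e : Bond n) →
  Chain (b ∷ bs ++ e ∷ []) → toℕ (src e) ≡ (toℕ (src b) + arcSum (b ∷ bs)) % n
Chain⇒src-last {n} b [] e (b→e , _) = begin
  toℕ (src e)                             ≡⟨ b→e ⟨
  (toℕ (src b) + arcVal (arc b)) % n       ≡⟨ cong (λ x → (toℕ (src b) + x) % n) (+-identityʳ _) ⟨
  (toℕ (src b) + arcSum (b ∷ [])) % n      ∎
  where open ≡-Reasoning
Chain⇒src-last {n} b (c ∷ cs) e (b→c , chain) = begin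
  toℕ (src e)                                            ≡⟨ Chain⇒src-last c cs e chain ⟩
  (toℕ (src c) + arcSum (c ∷ cs)) % n                     ≡⟨ cong (λ x → (x + arcSum (c ∷ cs)) % n) b→c ⟨
  ((toℕ (src b) + arcVal (arc b)) % n + arcSum (c ∷ cs)) % n
    ≡⟨ [m%d+n]%d≡[m+n]%d (toℕ (src b) + arcVal (arc b)) (arcSum (c ∷ cs)) n ⟩
  (toℕ (src b) + arcVal (arc b) + arcSum (c ∷ cs)) % n    ≡⟨ cong (_% n) (+-assoc (toℕ (src b)) _ _) ⟩
  (toℕ (src b) + arcSum (b ∷ c ∷ cs)) % n                 ∎
  where open ≡-Reasoning

n∣walkSum : ∀ {n} .{{_ : NonZero n}} (c : Circuit n) → n ∣ walkSum c
n∣walkSum {n} (b ∷ bs , closed) =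
  m≡[m+n]%d⇒d∣n (toℕ (src b)) (arcSum (b ∷ bs)) n (Chain⇒src-last b bs b closed)

len≤walkSum : ∀ {n} .{{_ : NonZero n}} (c : Circuit n) → len c ≤ walkSum c
len≤walkSum (bs , _) = length≤arcSum bs

walkSum≤2*len : ∀ {n} .{{_ : NonZero n}} (c : Circuit n) → walkSum c ≤ 2 * len c
walkSum≤2*len (bs , _) = arcSum≤2*length bs

0<len : ∀ {n} .{{_ : NonZero n}} (c : Circuit n) → 0 < len c
0<len (_ ∷ _ , _) = s≤s z≤n

len<n⇒walkSum≡n : ∀ {n} .{{_ : NonZero n}} (c : Circuit n) → len c < n → walkSum c ≡ n
len<n⇒walkSum≡n {n} c len<n = d∣n⇒0<n⇒n<2d⇒n≡d (n∣walkSum c)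
  (<-≤-trans (0<len c) (len≤walkSum c))
  (≤-<-trans (walkSum≤2*len c) (*-monoʳ-< 2 len<n))

len<n⇒n≤2*len : ∀ {n} .{{_ : NonZero n}} (c : Circuit n) → len c < n → n ≤ 2 * len c
len<n⇒n≤2*len c len<n = subst (_≤ 2 * len c) (len<n⇒walkSum≡n c len<n) (walkSum≤2*len c)

lemma6 : (n : ℕ) .{{_ : NonZero n}} → 2 < n →
    (γ : PseudoOrbit n) → PrimitivePseudoOrbit γ →
    0 < pseudoLength γ → pseudoLength γ < n →
    ∃ λ (c : Circuit n) → γ ≡ c ∷ [] × Primitive c × len c ≡ pseudoLength γ × walkSum c ≡ n
lemma6 n _ [] _ () _
lemma6 n _ (c ∷ []) (primitive-c ∷ _ , _) _ l<n =
  c , refl , primitive-c , sym (+-identityʳ (len c)) ,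
  len<n⇒walkSum≡n c (subst (_< n) (+-identityʳ (len c)) l<n)
lemma6 n _ (c ∷ d ∷ γ) _ _ l<n = contradiction 2n≤2l (<⇒≱ (*-monoʳ-< 2 l<n))
  where
  l = pseudoLength (c ∷ d ∷ γ)
  lc+ld≤l : len c + len d ≤ l
  lc+ld≤l = +-monoʳ-≤ (len c) (m≤m+n (len d) (pseudoLength γ))
  2n≤2l : 2 * n ≤ 2 * l
  2n≤2l = begin
    2 * n                   ≡⟨ cong (n +_) (+-identityʳ n) ⟩
    n + n                   ≤⟨ +-mono-≤ (len<n⇒n≤2*len c (≤-<-trans (m≤m+n (len c) (len d)) lc+ld<n))
                                        (len<n⇒n≤2*len d (≤-<-trans (m≤n+m (len d) (len c)) lc+ld<n)) ⟩
    2 * len c + 2 * len d   ≡⟨ *-distribˡ-+ 2 (len c) (len d) ⟨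
    2 * (len c + len d)     ≤⟨ *-monoʳ-≤ 2 lc+ld≤l ⟩
    2 * l                   ∎
    where
    open ≤-Reasoning
    lc+ld<n : len c + len d < n
    lc+ld<n = ≤-<-trans lc+ld≤l l<n
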